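{- Let $n,d\ge1$ and let $C=L_1;\ldots;L_{d'}$ be a comparator network on $n$ channels with $d'\le d$. Let $\mathcal B^n_{un(C)}=\{\vec x\in\{0,1\}^n: C(\vec x)\text{ is not sorted}\}$. Then there exists a sorting network on $n$ channels of depth $d$ with prefix $C$ (i.e. of the form $C;D$) if and only if the formula $\Psi(n,d,\mathcal B^n_{un(C)})\wedge\varphi^{fixed}(n,d,C)$ is satisfiable, where $\varphi^{fixed}(n,d,C)=\bigwedge_{1\le\ell\le d'}\bigwedge_{1\le i<j\le n}\big(c^\ell_{i,j}\leftrightarrow[(i,j)\in L_\ell]\big)$, with $[(i,j)\in L_\ell]$ the truth constant of that membership.
   Context: A comparator network on $n$ channels of depth $d$ is a sequence of $d$ layers; each layer is a (possibly empty) set of comparators $(i,j)$, $1\le i<j\le n$, with each channel in at most one comparator of the layer; comparator $(i,j)$ puts the minimum of the values on channels $i,j$ on channel $i$ and the maximum on channel $j$, untouched channels keep their values; a sorting network sorts every input ascendingly. The formula $\Psi$. Variables: $c^\ell_{i,j}$ ($1\le\ell\le d$, $1\le i<j\le n$), $u^\ell_k$ ($1\le\ell\le d$, $1\le k\le n$), and for each $\bar b\in X$ a separate family $x^{\bar b,\ell}_k$ ($1\le\ell\le d$, $1\le k\le n$), with $x^{\bar b,0}_k$ the constant $b_k$. Let $\mathrm{inc}^\ell_k=\{c^\ell_{i,j}: i=k\text{ or }j=k\}$. $\varphi^{used}=\bigwedge_{\ell,k}(u^\ell_k\leftrightarrow\bigvee\mathrm{inc}^\ell_k)$; $\varphi^{valid}=\bigwedge_{\ell,k}\bigwedge_{p\ne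 q\in\mathrm{inc}^\ell_k}(\neg p\vee\neg q)$; $\varphi^\ell(\bar x,\bar y)=\bigwedge_{i<j}(c^\ell_{i,j}\to((y_i\leftrightarrow x_i\wedge x_j)\wedge(y_j\leftrightarrow x_i\vee x_j)))\wedge\bigwedge_k(\neg u^\ell_k\to(x_k\leftrightarrow y_k))$; $\varphi^{sort}(\bar b)=\bigwedge_{\ell=1}^d\varphi^\ell(\bar x^{\bar b,\ell-1},\bar x^{\bar b,\ell})\wedge\bigwedge_i(x^{\bar b,d}_i\leftrightarrow b'_i)$ with $\bar b'$ the ascending sort of $\bar b$; $\Psi(n,d,X)=\varphi^{used}\wedge\varphi^{valid}\wedge\bigwedge_{\bar b\in X}\varphi^{sort}(\bar b)$. -}

module Defs where

open import Data.Nat using (ℕ; zero; suc; _≤_; _<ᵇ_; _⊓_; _⊔_)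
open import Data.Nat.Base using (_≡ᵇ_)
open import Data.Bool using (Bool; true; false; not; _∧_; _∨_; _xor_; if_then_else_)
open import Data.Fin using (Fin; zero; suc; toℕ; inject₁; fromℕ; _≟_)
import Data.Fin as F
open import Data.List using (List; []; _∷_; _++_; map; concatMap; allFin; foldl; length)
open import Data.Bool.ListAction using (any; and)
open import Data.List.Relation.Unary.All using (All)
open import Data.Vec using (Vec; lookup) renaming ([] to []ᵥ; _∷_ to _∷ᵥ_)
open import Data.Product using (_×_; _,_; ∃)
open import Data.Maybe using (Maybe; just; nothing)
open import Relation.Nullary using (¬_; does)
open import Relation.Binary.PropositionalEquality using (_≡_; _≢_)

infixr 6 _∧ᶠ_
infixr 5 _∨ᶠ_
infixr 4 _⇒ᶠ_ _⇔ᶠ_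

data Form (V : Set) : Set where
  var   : V → Form V
  const : Bool → Form V
  ¬ᶠ_   : Form V → Form V
  _∧ᶠ_ _∨ᶠ_ _⇒ᶠ_ _⇔ᶠ_ : Form V → Form V → Form V

⟦_⟧ : {V : Set} → Form V → (V → Bool) → Bool
⟦ var v ⟧ α = α v
⟦ const b ⟧ α = b
⟦ ¬ᶠ f ⟧ α = not (⟦ f ⟧ α)
⟦ f ∧ᶠ g ⟧ α = ⟦ f ⟧ α ∧ ⟦ g ⟧ α
⟦ f ∨ᶠ g ⟧ α = ⟦ f ⟧ α ∨ ⟦ g ⟧ α
⟦ f ⇒ᶠ g ⟧ α = not (⟦ f ⟧ α) ∨ ⟦ g ⟧ α
⟦ f ⇔ᶠ g ⟧ α = not (⟦ f ⟧ α xor ⟦ g ⟧ α)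

Satisfiable : {V : Set} → Form V → Set
Satisfiable {V} f = ∃ λ (α : V → Bool) → ⟦ f ⟧ α ≡ true

⋀ : {V : Set} → List (Form V) → Form V
⋀ [] = const true
⋀ (f ∷ fs) = f ∧ᶠ ⋀ fs

⋁ : {V : Set} → List (Form V) → Form V
⋁ [] = const false
⋁ (f ∷ fs) = f ∨ᶠ ⋁ fs

pairs : (n : ℕ) → List (Fin n × Fin n)
pairs n = concatMap (λ i → concatMap (λ j → if toℕ i <ᵇ toℕ j then (i , j) ∷ [] else []) (allFin n)) (allFin n)

pairsOf : {A : Set} → List A → List (A × A)
pairsOf [] = []
pairsOf (a ∷ as) = map (a ,_) as ++ pairsOf as

allVecs : (n : ℕ) → List (Vec Bool n)
allVecs zero = []ᵥ ∷ []
allVecs (suc n) = concatMap (λ v → (false ∷ᵥ v) ∷ (true ∷ᵥ v) ∷ []) (allVecs n)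

nth : {A : Set} → List A → ℕ → Maybe A
nth [] _ = nothing
nth (a ∷ as) zero = just a
nth (a ∷ as) (suc k) = nth as k

Comparator : ℕ → Set
Comparator n = Fin n × Fin n

Layer : ℕ → Set
Layer n = List (Comparator n)

Network : ℕ → Set
Network n = List (Layer n)

Disjoint : {n : ℕ} → Comparator n × Comparator n → Set
Disjoint ((i , j) , (i' , j')) = i ≢ i' × i ≢ j' × j ≢ i' × j ≢ j'

ValidLayer : {n : ℕ} → Layer n → Set
ValidLayer L = All (λ { (i , j) → i F.< j }) L × All Disjoint (pairsOf L)

ComparatorNetwork : {n : ℕ} → Network n → Set
ComparatorNetwork C = All ValidLayer C

module Run {A : Set} (mn mx : A → A → A) where
  applyComp : {n : ℕ} → Comparator n → (Fin n → A) → (Fin n → A)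
  applyComp (i , j) v k =
    if does (k ≟ i) then mn (v i) (v j)
    else if does (k ≟ j) then mx (v i) (v j)
    else v k

  applyLayer : {n : ℕ} → Layer n → (Fin n → A) → (Fin n → A)
  applyLayer L v = foldl (λ w c → applyComp c w) v L

  run : {n : ℕ} → Network n → (Fin n → A) → (Fin n → A)
  run C v = foldl (λ w L → applyLayer L w) v C

runℕ : {n : ℕ} → Network n → (Fin n → ℕ) → (Fin n → ℕ)
runℕ = Run.run _⊓_ _⊔_

runB : {n : ℕ} → Network n → (Fin n → Bool) → (Fin n → Bool)
runB = Run.run _∧_ _∨_

Sorts : {n : ℕ} → Network n → Set
Sorts {n} N = (v : Fin n → ℕ) (i j : Fin n) → i F.≤ j → runℕ N v i ≤ runℕ N v j

IsSortingNetwork : (n d : ℕ) → Network n → Set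
IsSortingNetwork n d N = ComparatorNetwork N × length N ≡ d × Sorts N

sortedᵇ : {n : ℕ} → (Fin n → Bool) → Bool
sortedᵇ {n} v = and (map (λ { (i , j) → not (v i ∧ not (v j)) }) (pairs n))

Bun : {n : ℕ} → Network n → Vec Bool n → Bool
Bun C b = not (sortedᵇ (runB C (lookup b)))

countFalse : {n : ℕ} → Vec Bool n → ℕ
countFalse []ᵥ = 0
countFalse (false ∷ᵥ b) = suc (countFalse b)
countFalse (true ∷ᵥ b) = countFalse b

sortB : {n : ℕ} → Vec Bool n → Fin n → Bool
sortB b i = not (toℕ i <ᵇ countFalse b)

-- The formula Ψ.  Layer ℓ ∈ {1..d} is represented by (ℓ-1) : Fin d.

data Var (n d : ℕ) : Set where
  c : Fin d → Fin n → Fin n → Var n d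
  u : Fin d → Fin n → Var n d
  x : Vec Bool n → Fin d → Fin n → Var n d

module _ {n d : ℕ} where
  inc : Fin d → Fin n → List (Form (Var n d))
  inc ℓ k = concatMap (λ { (i , j) → if does (i ≟ k) ∨ does (j ≟ k) then var (c ℓ i j) ∷ [] else [] }) (pairs n)

  φused : Form (Var n d)
  φused = ⋀ (concatMap (λ ℓ → map (λ k → var (u ℓ k) ⇔ᶠ ⋁ (inc ℓ k)) (allFin n)) (allFin d))

  φvalid : Form (Var n d)
  φvalid = ⋀ (concatMap (λ ℓ → concatMap (λ k →
             map (λ { (p , q) → ¬ᶠ p ∨ᶠ ¬ᶠ q }) (pairsOf (inc ℓ k))) (allFin n)) (allFin d))

  φlayer : Fin d → (Fin n → Form (Var n d)) → (Fin n → Form (Var n d)) → Form (Var n d)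
  φlayer ℓ xs ys =
    ⋀ (map (λ { (i , j) → var (c ℓ i j) ⇒ᶠ ((ys i ⇔ᶠ (xs i ∧ᶠ xs j)) ∧ᶠ (ys j ⇔ᶠ (xs i ∨ᶠ xs j))) }) (pairs n))
    ∧ᶠ ⋀ (map (λ k → ¬ᶠ var (u ℓ k) ⇒ᶠ (xs k ⇔ᶠ ys k)) (allFin n))

  -- x^{b,ℓ}_k for ℓ ∈ {0..d}; x^{b,0}_k is the constant b_k
  xT : Vec Bool n → Fin (suc d) → Fin n → Form (Var n d)
  xT b zero k = const (lookup b k)
  xT b (suc ℓ) k = var (x b ℓ k)

  φsort : Vec Bool n → Form (Var n d)
  φsort b = ⋀ (map (λ ℓ → φlayer ℓ (xT b (inject₁ ℓ)) (xT b (suc ℓ))) (allFin d))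
            ∧ᶠ ⋀ (map (λ i → xT b (fromℕ d) i ⇔ᶠ const (sortB b i)) (allFin n))

-- Ψ(n, d, X) with X ⊆ {0,1}^n given by its characteristic function
Ψ : (n d : ℕ) → (Vec Bool n → Bool) → Form (Var n d)
Ψ n d X = φused ∧ᶠ φvalid ∧ᶠ ⋀ (concatMap (λ b → if X b then φsort b ∷ [] else []) (allVecs n))

memᵇ : {n : ℕ} → Comparator n → Layer n → Bool
memᵇ (i , j) L = any (λ { (i' , j') → does (i ≟ i') ∧ does (j ≟ j') }) L

φfixed : (n d : ℕ) → Network n → Form (Var n d)
φfixed n d C = ⋀ (map (λ ℓ → fixLayer ℓ (nth C (toℕ ℓ))) (allFin d))
  where
  fixLayer : Fin d → Maybe (Layer n) → Form (Var n d)
  fixLayer ℓ nothing = const true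
  fixLayer ℓ (just L) = ⋀ (map (λ { (i , j) → var (c ℓ i j) ⇔ᶠ const (memᵇ (i , j) L) }) (pairs n))

module Submission where

-- An assignment α describes a depth-d network by its variables c^ℓ_{i,j};
-- φused and φvalid make the comparators chosen in each layer disjoint, and for
-- every input b ∈ X the clauses φsort(b) make x^{b,ℓ} the trace of b through the
-- network, ending in the sorted vector sortB b.
--   (⇒) Encode C;D: c = membership of comparators, u = "channel touched",
--       x = runs of the prefixes of C;D.
--   (⇐) Decode the layers d'+1..d of α as D.  By φfixed the layers of C choose
--       what α chooses, so C;D follows the traces of α and sorts B_un(C); every
--       other Boolean input is sorted by C already and stays sorted under D.
--       The 0-1 principle concludes.

open import Defs
open import Data.Nat using (ℕ; _≤_)
open import Data.List using (length; _++_)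
open import Data.Product using (∃)
open import Function.Bundles using (_⇔_)

open import Data.Nat using (zero; suc; _<_; _+_; _∸_; _⊓_; _⊔_; _<ᵇ_; _≤ᵇ_; z≤n; s≤s; _≤?_; _<?_)
import Data.Nat.Properties as ℕP
open import Data.Nat.Tactic.RingSolver using (solve-∀)
open import Data.Bool using (Bool; true; false; not; _∧_; _∨_; _xor_; if_then_else_; T)
open import Data.Bool.ListAction using (and)
import Data.Bool.Properties as BoolP
open import Data.Fin as F using (Fin; zero; suc; toℕ; inject₁; fromℕ)
import Data.Fin.Properties as FinP
open import Data.List using (List; []; _∷_; map; concatMap; allFin; take; drop; tabulate)
import Data.List.Properties as ListP
open import Data.List.Membership.Propositional using (_∈_; find)
open import Data.List.Membership.Propositional.Properties
  using (∈-map⁺; ∈-map⁻; ∈-++⁺ˡ; ∈-++⁺ʳ; ∈-++⁻; ∈-allFin; ∈-concatMap⁺; ∈-concatMap⁻)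
open import Data.List.Relation.Unary.Any as Any using (here; there)
open import Data.List.Relation.Unary.All as All using (All; []; _∷_)
import Data.List.Relation.Unary.All.Properties as AllP
open import Data.List.Relation.Unary.AllPairs using ([]; _∷_)
open import Data.List.Relation.Unary.Unique.Propositional using (Unique)
import Data.List.Relation.Unary.Unique.Propositional.Properties as UniqueP
open import Data.Vec using (Vec; lookup) renaming ([] to []ᵥ; _∷_ to _∷ᵥ_)
import Data.Vec as Vec
import Data.Vec.Properties as VecP
open import Data.Maybe using (just; nothing)
open import Data.Maybe.Properties using (just-injective)
open import Data.Product using (_×_; _,_; proj₁; proj₂)
open import Data.Sum using (_⊎_; inj₁; inj₂; [_,_])
open import Data.Empty using (⊥; ⊥-elim)
open import Data.Unit using (tt)
open import Function using (_∘_; id)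
open import Function.Bundles using (mk⇔)
open import Relation.Nullary using (¬_; yes; no; does)
open import Relation.Nullary.Decidable using (_×-dec_; _⊎-dec_)
open import Relation.Binary.PropositionalEquality
  using (_≡_; _≢_; refl; sym; trans; cong; cong₂; subst; subst₂; module ≡-Reasoning)

_⊨_ : {V : Set} → (V → Bool) → Form V → Set
α ⊨ f = ⟦ f ⟧ α ≡ true

T⇒true : ∀ {a} → T a → a ≡ true
T⇒true {true} _ = refl

true⇒T : ∀ {a} → a ≡ true → T a
true⇒T refl = tt

true≢false : true ≢ false
true≢false ()

∧-split : ∀ {a b} → a ∧ b ≡ true → a ≡ true × b ≡ true
∧-split {true} b≡true = refl , b≡true

∧-join : ∀ {a b} → a ≡ true → b ≡ true → a ∧ b ≡ true
∧-join refl refl = refl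

iff-true⁻ : ∀ {a b} → not (a xor b) ≡ true → a ≡ b
iff-true⁻ {false} {false} _ = refl
iff-true⁻ {true} {true} _ = refl

iff-true⁺ : ∀ {a b} → a ≡ b → not (a xor b) ≡ true
iff-true⁺ {false} refl = refl
iff-true⁺ {true} refl = refl

imp-true⁻ : ∀ {a b} → a ≡ true → not a ∨ b ≡ true → b ≡ true
imp-true⁻ refl b≡true = b≡true

imp-true⁺ : ∀ {a b} → (a ≡ true → b ≡ true) → not a ∨ b ≡ true
imp-true⁺ {false} _ = refl
imp-true⁺ {true} a⇒b = a⇒b refl

nand-true⁻ : ∀ {a b} → a ≡ true → b ≡ true → not a ∨ not b ≡ true → ⊥
nand-true⁻ refl refl ()

nand-true⁺ : ∀ {a b} → (a ≡ true → b ≡ true → ⊥) → not a ∨ not b ≡ true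
nand-true⁺ {false} _ = refl
nand-true⁺ {true} {false} _ = refl
nand-true⁺ {true} {true} both = ⊥-elim (both refl refl)

module _ {V : Set} (α : V → Bool) where
  ⋀-elim : ∀ {fs f} → α ⊨ ⋀ fs → f ∈ fs → α ⊨ f
  ⋀-elim {g ∷ fs} h (here refl) = proj₁ (∧-split {⟦ g ⟧ α} h)
  ⋀-elim {g ∷ fs} h (there f∈) = ⋀-elim (proj₂ (∧-split {⟦ g ⟧ α} h)) f∈

  ⋀-intro : ∀ fs → (∀ {f} → f ∈ fs → α ⊨ f) → α ⊨ ⋀ fs
  ⋀-intro [] _ = refl
  ⋀-intro (f ∷ fs) all-true = ∧-join (all-true (here refl)) (⋀-intro fs (all-true ∘ there))

  ⋀-map-false : ∀ {A : Set} {g : A → Form V} {xs} → ⟦ ⋀ (map g xs) ⟧ α ≡ false →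
                ∃ λ a → a ∈ xs × ⟦ g a ⟧ α ≡ false
  ⋀-map-false {g = g} {a ∷ xs} h with ⟦ g a ⟧ α in ga
  ... | false = a , here refl , ga
  ... | true = let b , b∈ , gb = ⋀-map-false {g = g} {xs} h in b , there b∈ , gb

  ⋁-elim : ∀ fs → α ⊨ ⋁ fs → ∃ λ f → f ∈ fs × α ⊨ f
  ⋁-elim (f ∷ fs) h with ⟦ f ⟧ α in αf
  ... | true = f , here refl , αf
  ... | false = let g , g∈ , αg = ⋁-elim fs h in g , there g∈ , αg

  ⋁-intro : ∀ {fs f} → f ∈ fs → α ⊨ f → α ⊨ ⋁ fs
  ⋁-intro (here refl) αf rewrite αf = refl
  ⋁-intro {f ∷ fs} (there g∈) αg rewrite ⋁-intro g∈ αg = BoolP.∨-zeroʳ (⟦ f ⟧ α)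

  ⋁-false : ∀ fs → (∀ {f} → f ∈ fs → ¬ α ⊨ f) → ⟦ ⋁ fs ⟧ α ≡ false
  ⋁-false fs none with ⟦ ⋁ fs ⟧ α in h
  ... | false = refl
  ... | true = let f , f∈ , αf = ⋁-elim fs h in ⊥-elim (none f∈ αf)

  ⋀-map⁻ : ∀ {A : Set} {g : A → Form V} {xs a} → α ⊨ ⋀ (map g xs) → a ∈ xs → α ⊨ g a
  ⋀-map⁻ {g = g} h a∈ = ⋀-elim h (∈-map⁺ g a∈)

  ⋀-map⁺ : ∀ {A : Set} {g : A → Form V} {xs} → (∀ {a} → a ∈ xs → α ⊨ g a) → α ⊨ ⋀ (map g xs)
  ⋀-map⁺ {g = g} {xs} all-true = ⋀-intro (map g xs) λ f∈ →
    let a , a∈ , f≡ = ∈-map⁻ g f∈ in subst (α ⊨_) (sym f≡) (all-true a∈)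

  ⋁-cong : ∀ (β : V → Bool) fs → (∀ {f} → f ∈ fs → ⟦ f ⟧ α ≡ ⟦ f ⟧ β) → ⟦ ⋁ fs ⟧ α ≡ ⟦ ⋁ fs ⟧ β
  ⋁-cong β [] _ = refl
  ⋁-cong β (f ∷ fs) same = cong₂ _∨_ (same (here refl)) (⋁-cong β fs (same ∘ there))

module _ {A B : Set} where
  ∈-concatMap-intro : ∀ {f : A → List B} {xs a y} → a ∈ xs → y ∈ f a → y ∈ concatMap f xs
  ∈-concatMap-intro {f} a∈ y∈ = ∈-concatMap⁺ f (Any.map (λ { refl → y∈ }) a∈)

  ∈-concatMap-elim : ∀ {f : A → List B} {xs y} → y ∈ concatMap f xs → ∃ λ a → a ∈ xs × y ∈ f a
  ∈-concatMap-elim {f} y∈ = find (∈-concatMap⁻ f y∈)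

  concatMap-unique : ∀ (f : A → List B) {xs} → Unique xs → (∀ a → Unique (f a)) →
                     (∀ {a a' y} → y ∈ f a → y ∈ f a' → a ≡ a') → Unique (concatMap f xs)
  concatMap-unique f {[]} _ _ _ = []
  concatMap-unique f {a ∷ xs} (a∉xs ∷ xs!) f! apart =
    UniqueP.++⁺ (f! a) (concatMap-unique f xs! f! apart) λ (y∈fa , y∈rest) →
      let a' , a'∈ , y∈fa' = ∈-concatMap-elim {f = f} y∈rest
      in All.lookup a∉xs a'∈ (apart y∈fa y∈fa')

  -- [ g a ] if p a holds and [] otherwise; Defs builds its filtered lists from these
  guarded : (A → Bool) → (A → B) → A → List B
  guarded p g a = if p a then g a ∷ [] else []

  select : (A → Bool) → (A → B) → List A → List B
  select p g = concatMap (guarded p g)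

  module _ (p : A → Bool) (g : A → B) where
    ∈-select⁺ : ∀ {xs a} → a ∈ xs → p a ≡ true → g a ∈ select p g xs
    ∈-select⁺ {a = a} a∈ pa = ∈-concatMap-intro {f = guarded p g} a∈ (∈-guarded pa)
      where
      ∈-guarded : ∀ {t} → t ≡ true → g a ∈ (if t then g a ∷ [] else [])
      ∈-guarded refl = here refl

    ∈-guarded⁻ : ∀ a {y} → y ∈ guarded p g a → p a ≡ true × y ≡ g a
    ∈-guarded⁻ a y∈ with p a
    ∈-guarded⁻ a (here refl) | true = refl , refl

    ∈-select⁻ : ∀ {xs y} → y ∈ select p g xs → ∃ λ a → a ∈ xs × p a ≡ true × y ≡ g a
    ∈-select⁻ y∈ =
      let a , a∈ , y∈ga = ∈-concatMap-elim {f = guarded p g} y∈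
          pa , y≡ = ∈-guarded⁻ a y∈ga
      in a , a∈ , pa , y≡

    select-unique : (∀ {a a'} → g a ≡ g a' → a ≡ a') → ∀ {xs} → Unique xs → Unique (select p g xs)
    select-unique g-injective xs! = concatMap-unique (guarded p g) xs! guarded! apart
      where
      guarded! : ∀ a → Unique (guarded p g a)
      guarded! a with p a
      ... | true = [] ∷ []
      ... | false = []
      apart : ∀ {a a' y} → y ∈ guarded p g a → y ∈ guarded p g a' → a ≡ a'
      apart {a} {a'} y∈ y∈' =
        g-injective (trans (sym (proj₂ (∈-guarded⁻ a y∈))) (proj₂ (∈-guarded⁻ a' y∈')))

module _ {n : ℕ} where
  ascending : Fin n → Fin n → Bool
  ascending i j = toℕ i <ᵇ toℕ j

  row : Fin n → List (Comparator n)
  row i = select (ascending i) (i ,_) (allFin n)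

  ∈-pairs⁻ : ∀ {i j : Fin n} → (i , j) ∈ pairs n → i F.< j
  ∈-pairs⁻ ij∈ with ∈-concatMap-elim {f = row} {xs = allFin n} ij∈
  ... | i , _ , ij∈row with ∈-select⁻ (ascending i) (i ,_) {xs = allFin n} ij∈row
  ... | j , _ , i<ᵇj , refl = ℕP.<ᵇ⇒< (toℕ i) (toℕ j) (true⇒T i<ᵇj)

  ∈-pairs⁺ : ∀ {i j : Fin n} → i F.< j → (i , j) ∈ pairs n
  ∈-pairs⁺ {i} {j} i<j = ∈-concatMap-intro {f = row} (∈-allFin i)
    (∈-select⁺ (ascending i) (i ,_) (∈-allFin j) (T⇒true (ℕP.<⇒<ᵇ i<j)))

  pairs-unique : Unique (pairs n)
  pairs-unique = concatMap-unique row (UniqueP.allFin⁺ n) row! apart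
    where
    row! : ∀ i → Unique (row i)
    row! i = select-unique (ascending i) (i ,_) (λ { refl → refl }) (UniqueP.allFin⁺ n)
    apart : ∀ {i i' y} → y ∈ row i → y ∈ row i' → i ≡ i'
    apart {i} {i'} y∈ y∈' with ∈-select⁻ (ascending i) (i ,_) {xs = allFin n} y∈
                             | ∈-select⁻ (ascending i') (i' ,_) {xs = allFin n} y∈'
    ... | _ , _ , _ , refl | _ , _ , _ , refl = refl

module _ {A : Set} where
  ∈-pairsOf⁻ : ∀ {a b : A} {xs} → Unique xs → (a , b) ∈ pairsOf xs → a ∈ xs × b ∈ xs × a ≢ b
  ∈-pairsOf⁻ {xs = y ∷ xs} (y∉xs ∷ xs!) ab∈ with ∈-++⁻ (map (y ,_) xs) ab∈
  ... | inj₁ ab∈row with ∈-map⁻ (y ,_) ab∈row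
  ...   | _ , b∈ , refl = here refl , there b∈ , All.lookup y∉xs b∈
  ∈-pairsOf⁻ {xs = y ∷ xs} (_ ∷ xs!) _ | inj₂ ab∈ =
    let a∈ , b∈ , a≢b = ∈-pairsOf⁻ xs! ab∈ in there a∈ , there b∈ , a≢b

  ∈-pairsOf⁺ : ∀ {a b : A} {xs} → a ∈ xs → b ∈ xs → a ≢ b → (a , b) ∈ pairsOf xs ⊎ (b , a) ∈ pairsOf xs
  ∈-pairsOf⁺ (here refl) (here refl) a≢b = ⊥-elim (a≢b refl)
  ∈-pairsOf⁺ {xs = y ∷ xs} (here refl) (there b∈) _ = inj₁ (∈-++⁺ˡ (∈-map⁺ (y ,_) b∈))
  ∈-pairsOf⁺ {xs = y ∷ xs} (there a∈) (here refl) _ = inj₂ (∈-++⁺ˡ (∈-map⁺ (y ,_) a∈))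
  ∈-pairsOf⁺ {xs = y ∷ xs} (there a∈) (there b∈) a≢b with ∈-pairsOf⁺ a∈ b∈ a≢b
  ... | inj₁ ab∈ = inj₁ (∈-++⁺ʳ (map (y ,_) xs) ab∈)
  ... | inj₂ ba∈ = inj₂ (∈-++⁺ʳ (map (y ,_) xs) ba∈)

allVecs-complete : ∀ {n} (b : Vec Bool n) → b ∈ allVecs n
allVecs-complete []ᵥ = here refl
allVecs-complete (false ∷ᵥ b) = ∈-concatMap-intro (allVecs-complete b) (here refl)
allVecs-complete (true ∷ᵥ b) = ∈-concatMap-intro (allVecs-complete b) (there (here refl))

module _ {n : ℕ} where
  memᵇ-true⁻ : ∀ {i j : Fin n} (L : Layer n) → memᵇ (i , j) L ≡ true → (i , j) ∈ L
  memᵇ-true⁻ {i} {j} ((i' , j') ∷ L) h with i F.≟ i' | j F.≟ j'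
  ... | yes refl | yes refl = here refl
  ... | yes _ | no _ = there (memᵇ-true⁻ L h)
  ... | no _ | _ = there (memᵇ-true⁻ L h)

  memᵇ-true⁺ : ∀ {i j : Fin n} (L : Layer n) → (i , j) ∈ L → memᵇ (i , j) L ≡ true
  memᵇ-true⁺ {i} {j} (_ ∷ L) (here refl) with i F.≟ i | j F.≟ j
  ... | yes _ | yes _ = refl
  ... | no i≢i | _ = ⊥-elim (i≢i refl)
  ... | yes _ | no j≢j = ⊥-elim (j≢j refl)
  memᵇ-true⁺ (_ ∷ L) (there ij∈) = trans (cong (_ ∨_) (memᵇ-true⁺ L ij∈)) (BoolP.∨-zeroʳ _)

module _ {A : Set} where
  nth-++ˡ : ∀ (xs ys : List A) {m} → m < length xs → nth (xs ++ ys) m ≡ nth xs m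
  nth-++ˡ (a ∷ xs) ys {zero} _ = refl
  nth-++ˡ (a ∷ xs) ys {suc m} (s≤s m<) = nth-++ˡ xs ys m<

  nth-++ʳ : ∀ (xs ys : List A) m → nth (xs ++ ys) (length xs + m) ≡ nth ys m
  nth-++ʳ [] ys m = refl
  nth-++ʳ (a ∷ xs) ys m = nth-++ʳ xs ys m

  nth-drop : ∀ k (xs : List A) m → nth (drop k xs) m ≡ nth xs (k + m)
  nth-drop zero xs m = refl
  nth-drop (suc k) [] m = refl
  nth-drop (suc k) (a ∷ xs) m = nth-drop k xs m

  nth-tabulate : ∀ {d} (f : Fin d → A) (ℓ : Fin d) → nth (tabulate f) (toℕ ℓ) ≡ just (f ℓ)
  nth-tabulate f zero = refl
  nth-tabulate f (suc ℓ) = nth-tabulate (f ∘ suc) ℓ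

  nth-defined : ∀ (xs : List A) {m} → m < length xs → ∃ λ a → nth xs m ≡ just a
  nth-defined (a ∷ xs) {zero} _ = a , refl
  nth-defined (a ∷ xs) {suc m} (s≤s m<) = nth-defined xs m<

  nth-bound : ∀ (xs : List A) {m a} → nth xs m ≡ just a → m < length xs
  nth-bound (_ ∷ xs) {zero} _ = s≤s z≤n
  nth-bound (_ ∷ xs) {suc m} h = s≤s (nth-bound xs h)

  nth-All : ∀ {P : A → Set} {xs m a} → All P xs → nth xs m ≡ just a → P a
  nth-All {xs = _ ∷ _} {zero} (pa ∷ _) refl = pa
  nth-All {xs = _ ∷ _} {suc m} (_ ∷ ps) h = nth-All ps h

  take-suc : ∀ (xs : List A) {m a} → nth xs m ≡ just a → take (suc m) xs ≡ take m xs ++ a ∷ []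
  take-suc (_ ∷ xs) {zero} refl = refl
  take-suc (b ∷ xs) {suc m} h = cong (b ∷_) (take-suc xs h)

Touches : ∀ {n} → Comparator n → Fin n → Set
Touches (i , j) k = i ≡ k ⊎ j ≡ k

disjoint-apart : ∀ {n} {a b : Comparator n} {k} → Disjoint (a , b) → Touches a k → ¬ Touches b k
disjoint-apart (i≢i' , _ , _ , _) (inj₁ refl) (inj₁ i'≡i) = i≢i' (sym i'≡i)
disjoint-apart (_ , i≢j' , _ , _) (inj₁ refl) (inj₂ j'≡i) = i≢j' (sym j'≡i)
disjoint-apart (_ , _ , j≢i' , _) (inj₂ refl) (inj₁ i'≡j) = j≢i' (sym i'≡j)
disjoint-apart (_ , _ , _ , j≢j') (inj₂ refl) (inj₂ j'≡j) = j≢j' (sym j'≡j)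

apart⇒disjoint : ∀ {n} {a b : Comparator n} → (∀ {k} → Touches a k → Touches b k → ⊥) → Disjoint (a , b)
apart⇒disjoint apart = (λ e → apart (inj₁ refl) (inj₁ (sym e))) , (λ e → apart (inj₁ refl) (inj₂ (sym e))) ,
                       (λ e → apart (inj₂ refl) (inj₁ (sym e))) , (λ e → apart (inj₂ refl) (inj₂ (sym e)))

valid-apart : ∀ {n} {L : Layer n} {a b k} → ValidLayer L → a ∈ L → b ∈ L → a ≢ b →
              Touches a k → Touches b k → ⊥
valid-apart (_ , disjoint) a∈ b∈ a≢b ta tb with ∈-pairsOf⁺ a∈ b∈ a≢b
... | inj₁ ab∈ = disjoint-apart (All.lookup disjoint ab∈) ta tb
... | inj₂ ba∈ = disjoint-apart (All.lookup disjoint ba∈) tb ta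

valid-head : ∀ {n} {a : Comparator n} {L} → ValidLayer (a ∷ L) → All (λ b → Disjoint (a , b)) L
valid-head {a = a} {L} (_ , disjoint) = AllP.map⁻ (AllP.++⁻ˡ (map (a ,_) L) disjoint)

valid-tail : ∀ {n} {a : Comparator n} {L} → ValidLayer (a ∷ L) → ValidLayer L
valid-tail {a = a} {L} (_ ∷ ascending , disjoint) = ascending , AllP.++⁻ʳ (map (a ,_) L) disjoint

Idle : ∀ {n} → (Fin n → Fin n → Bool) → Fin n → Set
Idle M k = ∀ {i j} → i F.< j → M i j ≡ true → ¬ Touches (i , j) k

record IsLayer {n} (N : Network n) (m : ℕ) (M : Fin n → Fin n → Bool) (L : Layer n) : Set where
  field
    at      : nth N m ≡ just L
    valid   : ValidLayer L
    selects : ∀ {i j} → i F.< j → memᵇ (i , j) L ≡ M i j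

IsLayer-tail : ∀ {n} {L : Layer n} {N m M L'} → IsLayer (L ∷ N) (suc m) M L' → IsLayer N m M L'
IsLayer-tail layer = record { at = at ; valid = valid ; selects = selects }
  where open IsLayer layer

module Homomorphism {A B : Set} {mnA mxA : A → A → A} {mnB mxB : B → B → B} (h : A → B)
                    (h-mn : ∀ a a' → h (mnA a a') ≡ mnB (h a) (h a'))
                    (h-mx : ∀ a a' → h (mxA a a') ≡ mxB (h a) (h a')) where
  private
    module RA = Run mnA mxA
    module RB = Run mnB mxB

  comp-hom : ∀ {n} (a : Comparator n) v w → (∀ k → w k ≡ h (v k)) →
             ∀ k → RB.applyComp a w k ≡ h (RA.applyComp a v k)
  comp-hom (i , j) v w w≡ k with k F.≟ i | k F.≟ j
  ... | yes _ | _ rewrite w≡ i | w≡ j = sym (h-mn (v i) (v j))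
  ... | no _ | yes _ rewrite w≡ i | w≡ j = sym (h-mx (v i) (v j))
  ... | no _ | no _ = w≡ k

  layer-hom : ∀ {n} (L : Layer n) v w → (∀ k → w k ≡ h (v k)) →
              ∀ k → RB.applyLayer L w k ≡ h (RA.applyLayer L v k)
  layer-hom [] v w w≡ = w≡
  layer-hom (a ∷ L) v w w≡ = layer-hom L (RA.applyComp a v) (RB.applyComp a w) (comp-hom a v w w≡)

  run-hom : ∀ {n} (N : Network n) v w → (∀ k → w k ≡ h (v k)) →
            ∀ k → RB.run N w k ≡ h (RA.run N v k)
  run-hom [] v w w≡ = w≡
  run-hom (L ∷ N) v w w≡ = run-hom N (RA.applyLayer L v) (RB.applyLayer L w) (layer-hom L v w w≡)

module Semantics {A : Set} (mn mx : A → A → A) where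
  open Run mn mx
  open Homomorphism {mnA = mn} {mx} {mn} {mx} id (λ _ _ → refl) (λ _ _ → refl)

  layer-cong : ∀ {n} (L : Layer n) {v w} → (∀ k → v k ≡ w k) → ∀ k → applyLayer L v k ≡ applyLayer L w k
  layer-cong L v≡w k = sym (layer-hom L _ _ (sym ∘ v≡w) k)

  run-cong : ∀ {n} (N : Network n) {v w} → (∀ k → v k ≡ w k) → ∀ k → run N v k ≡ run N w k
  run-cong N v≡w k = sym (run-hom N _ _ (sym ∘ v≡w) k)

  applyComp-off : ∀ {n} {a : Comparator n} {k} → ¬ Touches a k → ∀ v → applyComp a v k ≡ v k
  applyComp-off {a = i , j} {k} off v with k F.≟ i | k F.≟ j
  ... | yes k≡i | _ = ⊥-elim (off (inj₁ (sym k≡i)))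
  ... | no _ | yes k≡j = ⊥-elim (off (inj₂ (sym k≡j)))
  ... | no _ | no _ = refl

  applyComp-min : ∀ {n} (i j : Fin n) v → applyComp (i , j) v i ≡ mn (v i) (v j)
  applyComp-min i j v with i F.≟ i
  ... | yes _ = refl
  ... | no i≢i = ⊥-elim (i≢i refl)

  applyComp-max : ∀ {n} {i j : Fin n} → i ≢ j → ∀ v → applyComp (i , j) v j ≡ mx (v i) (v j)
  applyComp-max {i = i} {j} i≢j v with j F.≟ i | j F.≟ j
  ... | yes j≡i | _ = ⊥-elim (i≢j (sym j≡i))
  ... | no _ | yes _ = refl
  ... | no _ | no j≢j = ⊥-elim (j≢j refl)

  applyLayer-off : ∀ {n} (L : Layer n) {k} → All (λ a → ¬ Touches a k) L → ∀ v → applyLayer L v k ≡ v k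
  applyLayer-off [] _ v = refl
  applyLayer-off (a ∷ L) (a-off ∷ L-off) v =
    trans (applyLayer-off L L-off (applyComp a v)) (applyComp-off a-off v)

  applyLayer-hit : ∀ {n} (L : Layer n) {i j} → ValidLayer L → (i , j) ∈ L → ∀ v →
                   applyLayer L v i ≡ mn (v i) (v j) × applyLayer L v j ≡ mx (v i) (v j)
  applyLayer-hit ((i , j) ∷ L) valid (here refl) v =
      trans (applyLayer-off L (others (inj₁ refl)) _) (applyComp-min i j v)
    , trans (applyLayer-off L (others (inj₂ refl)) _) (applyComp-max i≢j v)
    where
    i≢j = FinP.<⇒≢ (All.head (proj₁ valid))
    others : ∀ {k} → Touches (i , j) k → All (λ b → ¬ Touches b k) L
    others t = All.map (λ disjoint → disjoint-apart disjoint t) (valid-head valid)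
  applyLayer-hit (a ∷ L) {i} {j} valid (there ij∈) v =
    let min , max = applyLayer-hit L (valid-tail valid) ij∈ (applyComp a v)
    in trans min (cong₂ mn (same (inj₁ refl)) (same (inj₂ refl))) ,
       trans max (cong₂ mx (same (inj₁ refl)) (same (inj₂ refl)))
    where
    same : ∀ {k} → Touches (i , j) k → applyComp a v k ≡ v k
    same t = applyComp-off (λ ta → disjoint-apart (All.lookup (valid-head valid) ij∈) ta t) v

  record Step {n} (M : Fin n → Fin n → Bool) (v w : Fin n → A) : Set where
    field
      compared : ∀ {i j} → i F.< j → M i j ≡ true → w i ≡ mn (v i) (v j) × w j ≡ mx (v i) (v j)
      idle     : ∀ {k} → Idle M k → w k ≡ v k
  open Step

  Step-unique : ∀ {n} {M : Fin n → Fin n → Bool} {v w w'} → Step M v w → Step M v w' → ∀ k → w k ≡ w' k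
  Step-unique {M = M} S S' k
    with FinP.any? (λ i → FinP.any? (λ j →
           (i F.<? j) ×-dec (M i j BoolP.≟ true) ×-dec ((i F.≟ k) ⊎-dec (j F.≟ k))))
  ... | yes (i , j , i<j , m , inj₁ refl) =
    trans (proj₁ (compared S i<j m)) (sym (proj₁ (compared S' i<j m)))
  ... | yes (i , j , i<j , m , inj₂ refl) =
    trans (proj₂ (compared S i<j m)) (sym (proj₂ (compared S' i<j m)))
  ... | no untouched = trans (idle S idleₖ) (sym (idle S' idleₖ))
    where
    idleₖ : Idle M k
    idleₖ i<j m t = untouched (_ , _ , i<j , m , t)

  Step-resp : ∀ {n} {M : Fin n → Fin n → Bool} {v v' w w'} → (∀ k → v k ≡ v' k) → (∀ k → w k ≡ w' k) →
              Step M v w → Step M v' w'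
  Step-resp v≡ w≡ S = record
    { compared = λ i<j m → let min , max = compared S i<j m in
        trans (sym (w≡ _)) (trans min (cong₂ mn (v≡ _) (v≡ _))) ,
        trans (sym (w≡ _)) (trans max (cong₂ mx (v≡ _) (v≡ _)))
    ; idle = λ idleₖ → trans (sym (w≡ _)) (trans (idle S idleₖ) (v≡ _)) }

  applyLayer-Step : ∀ {n} {L : Layer n} → ValidLayer L →
                    ∀ v → Step (λ i j → memᵇ (i , j) L) v (applyLayer L v)
  applyLayer-Step {L = L} valid v = record
    { compared = λ _ m → applyLayer-hit L valid (memᵇ-true⁻ L m) v
    ; idle = λ idleₖ → applyLayer-off L
        (All.tabulate (λ a∈ → idleₖ (All.lookup (proj₁ valid) a∈) (memᵇ-true⁺ L a∈))) v }

  IsLayer-Step : ∀ {n} {N : Network n} {m M L} → IsLayer N m M L → ∀ v → Step M v (applyLayer L v)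
  IsLayer-Step layer v = record
    { compared = λ i<j m → compared S i<j (trans (IsLayer.selects layer i<j) m)
    ; idle = λ idleₖ → idle S (λ i<j m → idleₖ i<j (trans (sym (IsLayer.selects layer i<j)) m)) }
    where
    S = applyLayer-Step (IsLayer.valid layer) v

  run-trace : ∀ {n d} (N : Network n) {M : Fin d → Fin n → Fin n → Bool} → length N ≡ d →
              (∀ ℓ → ∃ (IsLayer N (toℕ ℓ) (M ℓ))) → (s : Fin (suc d) → Fin n → A) →
              (∀ ℓ → Step (M ℓ) (s (inject₁ ℓ)) (s (suc ℓ))) → ∀ k → run N (s zero) k ≡ s (fromℕ d) k
  run-trace [] refl _ s _ k = refl
  run-trace (L ∷ N) {M} refl layers s steps k =
    trans (run-cong N first k) (run-trace N refl later (s ∘ suc) (steps ∘ suc) k)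
    where
    first : ∀ k → applyLayer L (s zero) k ≡ s (suc zero) k
    first k rewrite just-injective (IsLayer.at (proj₂ (layers zero))) =
      Step-unique (IsLayer-Step (proj₂ (layers zero)) (s zero)) (steps zero) k
    later : ∀ ℓ → ∃ (IsLayer N (toℕ ℓ) (M (suc ℓ)))
    later ℓ = let L' , layer = layers (suc ℓ) in L' , IsLayer-tail layer

  run-++ : ∀ {n} (N N' : Network n) v → run (N ++ N') v ≡ run N' (run N v)
  run-++ N N' v = ListP.foldl-++ _ v N N'

  prefix : ∀ {n} → Network n → (Fin n → A) → ℕ → Fin n → A
  prefix N v m = run (take m N) v

  prefix-step : ∀ {n} (N : Network n) {m L} → nth N m ≡ just L → ∀ v k →
                applyLayer L (prefix N v m) k ≡ prefix N v (suc m) k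
  prefix-step N {m} {L} at v k = sym (begin
    run (take (suc m) N) v k          ≡⟨ cong (λ N' → run N' v k) (take-suc N at) ⟩
    run (take m N ++ L ∷ []) v k      ≡⟨ cong (λ w → w k) (run-++ (take m N) (L ∷ []) v) ⟩
    applyLayer L (prefix N v m) k     ∎)
    where open ≡-Reasoning

  prefix-all : ∀ {n d} (N : Network n) → length N ≡ d → ∀ v → prefix N v d ≡ run N v
  prefix-all {d = d} N depth v = cong (λ N' → run N' v) (ListP.take-all d N (ℕP.≤-reflexive depth))

-- Boolean runs, the 0-1 principle and the output of a sorting network

open Run _∧_ _∨_
open Semantics _∧_ _∨_

Sorted : ∀ {n} → (Fin n → Bool) → Set
Sorted v = ∀ {i j} → i F.< j → v i ≡ true → v j ≡ true

Sorted-resp : ∀ {n} {v w : Fin n → Bool} → (∀ k → v k ≡ w k) → Sorted v → Sorted w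
Sorted-resp v≡w sorted i<j wi = trans (sym (v≡w _)) (sorted i<j (trans (v≡w _) wi))

and-map-true : ∀ {A : Set} (g : A → Bool) {xs a} → and (map g xs) ≡ true → a ∈ xs → g a ≡ true
and-map-true g {b ∷ xs} h (here refl) = proj₁ (∧-split {g b} h)
and-map-true g {b ∷ xs} h (there a∈) = and-map-true g (proj₂ (∧-split {g b} h)) a∈

sortedᵇ⇒Sorted : ∀ {n} (v : Fin n → Bool) → sortedᵇ v ≡ true → Sorted v
sortedᵇ⇒Sorted v h i<j = ordered (and-map-true (λ (i , j) → not (v i ∧ not (v j))) h (∈-pairs⁺ i<j))
  where
  ordered : ∀ {a b} → not (a ∧ not b) ≡ true → a ≡ true → b ≡ true
  ordered {true} {true} _ _ = refl

-- false ↦ 0, true ↦ 1 embeds Boolean runs into runs on ℕ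
bit : Bool → ℕ
bit false = 0
bit true = 1

bit-∧ : ∀ a b → bit (a ∧ b) ≡ bit a ⊓ bit b
bit-∧ false _ = refl
bit-∧ true false = refl
bit-∧ true true = refl

bit-∨ : ∀ a b → bit (a ∨ b) ≡ bit a ⊔ bit b
bit-∨ false false = refl
bit-∨ false true = refl
bit-∨ true false = refl
bit-∨ true true = refl

Sorts⇒Sorted : ∀ {n} (N : Network n) → Sorts N → ∀ v → Sorted (runB N v)
Sorts⇒Sorted N sorts v {i} {j} i<j vi with runB N v j in vj
... | true = refl
... | false =
  ⊥-elim (1≰0 (subst₂ _≤_ (via-bits i vi) (via-bits j vj) (sorts (bit ∘ v) i j (ℕP.<⇒≤ i<j))))
  where
  open Homomorphism {mnA = _∧_} {_∨_} {_⊓_} {_⊔_} bit bit-∧ bit-∨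
  via-bits : ∀ k {b} → runB N v k ≡ b → runℕ N (bit ∘ v) k ≡ bit b
  via-bits k refl = run-hom N v (bit ∘ v) (λ _ → refl) k
  1≰0 : ¬ 1 ≤ 0
  1≰0 ()

module _ (f : ℕ → Bool) (monotone : ∀ {p q} → p ≤ q → f p ≡ true → f q ≡ true) where
  private
    absorb-∧ : ∀ {a b} → (a ≡ true → b ≡ true) → a ≡ a ∧ b
    absorb-∧ {false} _ = refl
    absorb-∧ {true} a⇒b = sym (a⇒b refl)

    absorb-∨ : ∀ {a b} → (a ≡ true → b ≡ true) → b ≡ a ∨ b
    absorb-∨ {false} _ = refl
    absorb-∨ {true} a⇒b = a⇒b refl

  monotone-⊓ : ∀ p q → f (p ⊓ q) ≡ f p ∧ f q
  monotone-⊓ p q with ℕP.≤-total p q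
  ... | inj₁ p≤q rewrite ℕP.m≤n⇒m⊓n≡m p≤q = absorb-∧ (monotone p≤q)
  ... | inj₂ q≤p rewrite ℕP.m≥n⇒m⊓n≡n q≤p = trans (absorb-∧ (monotone q≤p)) (BoolP.∧-comm (f q) (f p))

  monotone-⊔ : ∀ p q → f (p ⊔ q) ≡ f p ∨ f q
  monotone-⊔ p q with ℕP.≤-total p q
  ... | inj₁ p≤q rewrite ℕP.m≤n⇒m⊔n≡n p≤q = absorb-∨ (monotone p≤q)
  ... | inj₂ q≤p rewrite ℕP.m≥n⇒m⊔n≡m q≤p = trans (absorb-∨ (monotone q≤p)) (BoolP.∨-comm (f q) (f p))

atLeast : ℕ → ℕ → Bool
atLeast t p = t ≤ᵇ p

atLeast-true⁻ : ∀ t {p} → atLeast t p ≡ true → t ≤ p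
atLeast-true⁻ t {p} h = ℕP.≤ᵇ⇒≤ t p (true⇒T h)

atLeast-true⁺ : ∀ t {p} → t ≤ p → atLeast t p ≡ true
atLeast-true⁺ _ t≤p = T⇒true (ℕP.≤⇒≤ᵇ t≤p)

atLeast-monotone : ∀ t {p q} → p ≤ q → atLeast t p ≡ true → atLeast t q ≡ true
atLeast-monotone t p≤q h = atLeast-true⁺ t (ℕP.≤-trans (atLeast-true⁻ t h) p≤q)

-- 0-1 principle: a network that sorts every Boolean input sorts every input.
-- If outputs i < j were out of order, the Boolean input "v ≥ output i" would be unsorted.
zero-one-principle : ∀ {n} (N : Network n) → (∀ v → Sorted (runB N v)) → Sorts N
zero-one-principle N sortsᵇ v i j i≤j with runℕ N v i ≤? runℕ N v j
... | yes ordered = ordered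
... | no unordered = ⊥-elim (unordered (atLeast-true⁻ t (trans (sym (via-test j)) jth)))
  where
  t = runℕ N v i
  open Homomorphism {mnA = _⊓_} {_⊔_} {_∧_} {_∨_} (atLeast t)
         (monotone-⊓ (atLeast t) (atLeast-monotone t)) (monotone-⊔ (atLeast t) (atLeast-monotone t))
  via-test : ∀ k → runB N (atLeast t ∘ v) k ≡ atLeast t (runℕ N v k)
  via-test = run-hom N v (atLeast t ∘ v) (λ _ → refl)
  i<j : i F.< j
  i<j = FinP.≤∧≢⇒< i≤j (λ { refl → unordered ℕP.≤-refl })
  jth : runB N (atLeast t ∘ v) j ≡ true
  jth = sortsᵇ (atLeast t ∘ v) i<j (trans (via-test i) (atLeast-true⁺ t ℕP.≤-refl))

applyComp-sorted : ∀ {n} {i j : Fin n} → i F.< j → ∀ {v} → Sorted v → ∀ k → applyComp (i , j) v k ≡ v k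
applyComp-sorted {i = i} {j} i<j {v} sorted k with k F.≟ i | k F.≟ j
... | yes refl | _ with v k in vk
...   | false = refl
...   | true = sorted i<j vk
applyComp-sorted {i = i} {j} i<j {v} sorted k | no _ | yes refl with v i in vi
...   | false = refl
...   | true = sym (sorted i<j vi)
applyComp-sorted i<j sorted k | no _ | no _ = refl

applyLayer-sorted : ∀ {n} (L : Layer n) → All (λ (i , j) → i F.< j) L → ∀ {v} → Sorted v →
                    ∀ k → applyLayer L v k ≡ v k
applyLayer-sorted [] _ sorted k = refl
applyLayer-sorted ((i , j) ∷ L) (i<j ∷ ascending) sorted k =
  trans (layer-cong L (applyComp-sorted i<j sorted) k) (applyLayer-sorted L ascending sorted k)

run-sorted : ∀ {n} (N : Network n) → ComparatorNetwork N → ∀ {v} → Sorted v → ∀ k → runB N v k ≡ v k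
run-sorted [] _ sorted k = refl
run-sorted (L ∷ N) (valid ∷ valids) sorted k =
  trans (run-cong N (applyLayer-sorted L (proj₁ valid) sorted) k) (run-sorted N valids sorted k)

isFalse : Bool → ℕ
isFalse b = bit (not b)

falses : ∀ {n} → (Fin n → Bool) → ℕ
falses {zero} _ = 0
falses {suc n} v = isFalse (v zero) + falses (v ∘ suc)

countFalse≡falses : ∀ {n} (b : Vec Bool n) → countFalse b ≡ falses (lookup b)
countFalse≡falses []ᵥ = refl
countFalse≡falses (false ∷ᵥ b) = cong suc (countFalse≡falses b)
countFalse≡falses (true ∷ᵥ b) = countFalse≡falses b

falses-cong : ∀ {n} {v w : Fin n → Bool} → (∀ k → v k ≡ w k) → falses v ≡ falses w
falses-cong {zero} _ = refl
falses-cong {suc n} v≡w = cong₂ _+_ (cong isFalse (v≡w zero)) (falses-cong (v≡w ∘ suc))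

+-swapʳ : ∀ a b c → a + b + c ≡ a + c + b
+-swapʳ = solve-∀

falses-update : ∀ {n} (v w : Fin n → Bool) j → (∀ k → k ≢ j → w k ≡ v k) →
                falses w + isFalse (v j) ≡ falses v + isFalse (w j)
falses-update {suc n} v w zero same
  rewrite falses-cong {v = w ∘ suc} {v ∘ suc} (λ k → same (suc k) λ ()) =
  trans (+-swapʳ (isFalse (w zero)) _ _)
        (trans (cong (_+ falses (v ∘ suc)) (ℕP.+-comm (isFalse (w zero)) (isFalse (v zero))))
               (+-swapʳ (isFalse (v zero)) _ _))
falses-update {suc n} v w (suc j) same rewrite same zero (λ ()) = begin
  isFalse (v zero) + falses (w ∘ suc) + isFalse (v (suc j))   ≡⟨ ℕP.+-assoc (isFalse (v zero)) _ _ ⟩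
  isFalse (v zero) + (falses (w ∘ suc) + isFalse (v (suc j))) ≡⟨ cong (isFalse (v zero) +_) rest ⟩
  isFalse (v zero) + (falses (v ∘ suc) + isFalse (w (suc j))) ≡⟨ ℕP.+-assoc (isFalse (v zero)) _ _ ⟨
  isFalse (v zero) + falses (v ∘ suc) + isFalse (w (suc j))   ∎
  where
  open ≡-Reasoning
  rest = falses-update (v ∘ suc) (w ∘ suc) j (λ k k≢j → same (suc k) (k≢j ∘ FinP.suc-injective))

-- changing two entries without changing their isFalse sum preserves the count;
-- pass through the vector that agrees with w at i and with v elsewhere
falses-update₂ : ∀ {n} (v w : Fin n → Bool) {i j} → i ≢ j → (∀ k → k ≢ i → k ≢ j → w k ≡ v k) →
                 isFalse (w i) + isFalse (w j) ≡ isFalse (v i) + isFalse (v j) → falses w ≡ falses v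
falses-update₂ v w {i} {j} i≢j same balanced = ℕP.+-cancelʳ-≡ (isFalse (v i) + isFalse (v j)) _ _ (begin
  falses w + (isFalse (v i) + isFalse (v j))   ≡⟨ ℕP.+-assoc (falses w) _ _ ⟨
  falses w + isFalse (v i) + isFalse (v j)     ≡⟨ +-swapʳ (falses w) _ _ ⟩
  falses w + isFalse (v j) + isFalse (v i)     ≡⟨ cong (_+ isFalse (v i)) w-vs-mid ⟩
  falses mid + isFalse (w j) + isFalse (v i)   ≡⟨ +-swapʳ (falses mid) _ _ ⟩
  falses mid + isFalse (v i) + isFalse (w j)   ≡⟨ cong (_+ isFalse (w j)) mid-vs-v ⟩
  falses v + isFalse (w i) + isFalse (w j)     ≡⟨ ℕP.+-assoc (falses v) _ _ ⟩
  falses v + (isFalse (w i) + isFalse (w j))   ≡⟨ cong (falses v +_) balanced ⟩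
  falses v + (isFalse (v i) + isFalse (v j))   ∎)
  where
  open ≡-Reasoning
  mid : Fin _ → Bool
  mid k = if does (k F.≟ i) then w i else v k
  mid-i : mid i ≡ w i
  mid-i with i F.≟ i
  ... | yes _ = refl
  ... | no i≢i = ⊥-elim (i≢i refl)
  mid-off : ∀ k → k ≢ i → mid k ≡ v k
  mid-off k k≢i with k F.≟ i
  ... | yes k≡i = ⊥-elim (k≢i k≡i)
  ... | no _ = refl
  w-vs-mid-off : ∀ k → k ≢ j → w k ≡ mid k
  w-vs-mid-off k k≢j with k F.≟ i
  ... | yes refl = refl
  ... | no k≢i = same k k≢i k≢j
  w-vs-mid : falses w + isFalse (v j) ≡ falses mid + isFalse (w j)
  w-vs-mid = trans (cong (λ b → falses w + isFalse b) (sym (mid-off j (i≢j ∘ sym))))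
                   (falses-update mid w j w-vs-mid-off)
  mid-vs-v : falses mid + isFalse (v i) ≡ falses v + isFalse (w i)
  mid-vs-v = trans (falses-update v mid i mid-off) (cong (λ b → falses v + isFalse b) mid-i)

falses-applyComp : ∀ {n} {i j : Fin n} → i F.< j → ∀ v → falses (applyComp (i , j) v) ≡ falses v
falses-applyComp {i = i} {j} i<j v = falses-update₂ v (applyComp (i , j) v) i≢j
  (λ k k≢i k≢j → applyComp-off [ k≢i ∘ sym , k≢j ∘ sym ] v)
  (trans (cong₂ (λ a b → isFalse a + isFalse b) (applyComp-min i j v) (applyComp-max i≢j v))
         (balanced (v i) (v j)))
  where
  i≢j = FinP.<⇒≢ i<j
  balanced : ∀ a b → isFalse (a ∧ b) + isFalse (a ∨ b) ≡ isFalse a + isFalse b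
  balanced false false = refl
  balanced false true = refl
  balanced true false = refl
  balanced true true = refl

falses-run : ∀ {n} (N : Network n) → ComparatorNetwork N → ∀ v → falses (runB N v) ≡ falses v
falses-run [] _ v = refl
falses-run (L ∷ N) (valid ∷ valids) v =
  trans (falses-run N valids (applyLayer L v)) (falses-layer L (proj₁ valid) v)
  where
  falses-layer : ∀ (L : Layer _) → All (λ (i , j) → i F.< j) L → ∀ v → falses (applyLayer L v) ≡ falses v
  falses-layer [] _ v = refl
  falses-layer ((i , j) ∷ L) (i<j ∷ ascending) v =
    trans (falses-layer L ascending (applyComp (i , j) v)) (falses-applyComp i<j v)

falses-all-true : ∀ {n} (v : Fin n → Bool) → (∀ k → v k ≡ true) → falses v ≡ 0
falses-all-true {zero} v _ = refl
falses-all-true {suc m} v all rewrite all zero = falses-all-true (v ∘ suc) (all ∘ suc)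

sorted-shape : ∀ {n} (w : Fin n → Bool) → Sorted w → ∀ i → w i ≡ not (toℕ i <ᵇ falses w)
sorted-shape {suc n} w sorted i with w zero in w₀
... | true rewrite falses-all-true (w ∘ suc) (λ k → sorted {zero} {suc k} (s≤s z≤n) w₀) = all-true i
  where
  all-true : ∀ i → w i ≡ true
  all-true zero = w₀
  all-true (suc k) = sorted {zero} {suc k} (s≤s z≤n) w₀
... | false with i
...   | zero = w₀
...   | suc i' = sorted-shape (w ∘ suc) (λ i<j → sorted (s≤s i<j)) i'

sorting-output : ∀ {n} (N : Network n) → ComparatorNetwork N → Sorts N →
                 ∀ (b : Vec Bool n) k → runB N (lookup b) k ≡ sortB b k
sorting-output N cn sorts b k = trans (sorted-shape _ (Sorts⇒Sorted N sorts (lookup b)) k)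
  (cong (λ m → not (toℕ k <ᵇ m)) (trans (falses-run N cn (lookup b)) (sym (countFalse≡falses b))))

sortB-sorted : ∀ {n} (b : Vec Bool n) → Sorted (sortB b)
sortB-sorted b {i} {j} i<j ith with toℕ j <ᵇ countFalse b in j<
... | false = refl
... | true with toℕ i <ᵇ countFalse b in i<
...   | true = ith
...   | false = ⊥-elim (true≢false (trans (sym (T⇒true (ℕP.<⇒<ᵇ i<count))) i<))
  where
  i<count : toℕ i < countFalse b
  i<count = ℕP.<-trans i<j (ℕP.<ᵇ⇒< (toℕ j) (countFalse b) (true⇒T j<))

-- The meaning of the parts of Ψ and φfixed

module _ {n d : ℕ} where
  cvar : Fin d → Comparator n → Form (Var n d)
  cvar ℓ (i , j) = var (c ℓ i j)

  cvar-injective : ∀ {ℓ} {a b : Comparator n} → cvar ℓ a ≡ cvar ℓ b → a ≡ b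
  cvar-injective {a = _ , _} {_ , _} refl = refl

  touchesᵇ : Fin n → Comparator n → Bool
  touchesᵇ k (i , j) = does (i F.≟ k) ∨ does (j F.≟ k)

  touchesᵇ⁻ : ∀ {a k} → touchesᵇ k a ≡ true → Touches a k
  touchesᵇ⁻ {i , j} {k} h with i F.≟ k | j F.≟ k
  ... | yes i≡k | _ = inj₁ i≡k
  ... | no _ | yes j≡k = inj₂ j≡k

  touchesᵇ⁺ : ∀ {a k} → Touches a k → touchesᵇ k a ≡ true
  touchesᵇ⁺ {i , j} (inj₁ refl) with i F.≟ i
  ... | yes _ = refl
  ... | no i≢i = ⊥-elim (i≢i refl)
  touchesᵇ⁺ {i , j} (inj₂ refl) with j F.≟ j
  ... | yes _ = BoolP.∨-zeroʳ _
  ... | no j≢j = ⊥-elim (j≢j refl)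

  ∈-inc⁻ : ∀ {ℓ k f} → f ∈ inc ℓ k → ∃ λ a → a ∈ pairs n × Touches a k × f ≡ cvar ℓ a
  ∈-inc⁻ {ℓ} {k} f∈ =
    let a , a∈ , t , f≡ = ∈-select⁻ (touchesᵇ k) (cvar ℓ) {xs = pairs n} f∈ in a , a∈ , touchesᵇ⁻ t , f≡

  ∈-inc⁺ : ∀ {ℓ k a} → a ∈ pairs n → Touches a k → cvar ℓ a ∈ inc ℓ k
  ∈-inc⁺ {ℓ} {k} a∈ t = ∈-select⁺ (touchesᵇ k) (cvar ℓ) a∈ (touchesᵇ⁺ t)

  inc-unique : ∀ ℓ k → Unique (inc ℓ k)
  inc-unique ℓ k = select-unique (touchesᵇ k) (cvar ℓ) cvar-injective pairs-unique

module _ {n d : ℕ} (α : Var n d → Bool) where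
  chosen : Fin d → Fin n → Fin n → Bool
  chosen ℓ i j = α (c ℓ i j)

  -- α gives u^ℓ_k its intended meaning: channel k is touched in layer ℓ
  Used : Set
  Used = ∀ ℓ k → α (u ℓ k) ≡ ⟦ ⋁ (inc ℓ k) ⟧ α

  used⁻ : α ⊨ φused → Used
  used⁻ h ℓ k = iff-true⁻ (⋀-elim α h (∈-concatMap-intro (∈-allFin ℓ) (∈-map⁺ _ (∈-allFin k))))

  used⁺ : Used → α ⊨ φused
  used⁺ used = ⋀-intro α (concatMap (λ ℓ → map (used-clause ℓ) (allFin n)) (allFin d)) λ f∈ →
    let ℓ , _ , f∈ℓ = ∈-concatMap-elim {f = λ ℓ → map (used-clause ℓ) (allFin n)} {xs = allFin d} f∈
        k , _ , f≡ = ∈-map⁻ (used-clause ℓ) f∈ℓ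
    in subst (α ⊨_) (sym f≡) (iff-true⁺ (used ℓ k))
    where
    used-clause : Fin d → Fin n → Form (Var n d)
    used-clause ℓ k = var (u ℓ k) ⇔ᶠ ⋁ (inc ℓ k)

  inc-false⁻ : ∀ {ℓ k} → ⟦ ⋁ (inc ℓ k) ⟧ α ≡ false → Idle (chosen ℓ) k
  inc-false⁻ {ℓ} {k} h i<j m t = true≢false (trans (sym (⋁-intro α (∈-inc⁺ (∈-pairs⁺ i<j) t) m)) h)

  inc-false⁺ : ∀ {ℓ k} → Idle (chosen ℓ) k → ⟦ ⋁ (inc ℓ k) ⟧ α ≡ false
  inc-false⁺ {ℓ} {k} idleₖ = ⋁-false α (inc ℓ k) λ f∈ αf → idle-var f∈ αf
    where
    idle-var : ∀ {f} → f ∈ inc ℓ k → ¬ α ⊨ f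
    idle-var f∈ αf with ∈-inc⁻ f∈
    ... | _ , a∈ , t , refl = idleₖ (∈-pairs⁻ a∈) αf t

  layer⁻ : Used → ∀ ℓ xs ys → α ⊨ φlayer ℓ xs ys → Step (chosen ℓ) (λ k → ⟦ xs k ⟧ α) (λ k → ⟦ ys k ⟧ α)
  layer⁻ used ℓ xs ys h = record
    { compared = λ i<j m → let min , max = ∧-split (imp-true⁻ m (⋀-map⁻ α comparators (∈-pairs⁺ i<j)))
                           in iff-true⁻ min , iff-true⁻ max
    ; idle = λ {k} idleₖ → sym (iff-true⁻ (imp-true⁻ (cong not (trans (used ℓ k) (inc-false⁺ idleₖ)))
                                                     (⋀-map⁻ α untouched (∈-allFin k)))) }
    where
    comparators = proj₁ (∧-split h)
    untouched = proj₂ (∧-split h)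

  layer⁺ : Used → ∀ ℓ xs ys → Step (chosen ℓ) (λ k → ⟦ xs k ⟧ α) (λ k → ⟦ ys k ⟧ α) → α ⊨ φlayer ℓ xs ys
  layer⁺ used ℓ xs ys S = ∧-join
    (⋀-map⁺ α {g = comparator-clause} {pairs n} λ { {i , j} ij∈ → imp-true⁺ λ m →
       let min , max = Step.compared S (∈-pairs⁻ ij∈) m in ∧-join (iff-true⁺ min) (iff-true⁺ max) })
    (⋀-map⁺ α {g = idle-clause} {allFin n} λ {k} _ → imp-true⁺ λ not-used →
       iff-true⁺ (sym (Step.idle S (inc-false⁻ (trans (sym (used ℓ k)) (not-true⁻ not-used))))))
    where
    comparator-clause : Comparator n → Form (Var n d)
    comparator-clause (i , j) = var (c ℓ i j) ⇒ᶠ ((ys i ⇔ᶠ (xs i ∧ᶠ xs j)) ∧ᶠ (ys j ⇔ᶠ (xs i ∨ᶠ xs j)))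
    idle-clause : Fin n → Form (Var n d)
    idle-clause k = ¬ᶠ var (u ℓ k) ⇒ᶠ (xs k ⇔ᶠ ys k)
    not-true⁻ : ∀ {a} → not a ≡ true → a ≡ false
    not-true⁻ {false} _ = refl

  Exclusive : Set
  Exclusive = ∀ ℓ {k} {a b : Comparator n} → a ∈ pairs n → b ∈ pairs n → a ≢ b →
              Touches a k → Touches b k → α ⊨ cvar ℓ a → α ⊨ cvar ℓ b → ⊥

  valid-clause : α ⊨ φvalid → ∀ {ℓ k p q} → (p , q) ∈ pairsOf (inc ℓ k) → α ⊨ (¬ᶠ p ∨ᶠ ¬ᶠ q)
  valid-clause h {ℓ} {k} pq∈ =
    ⋀-elim α h (∈-concatMap-intro (∈-allFin ℓ) (∈-concatMap-intro (∈-allFin k) (∈-map⁺ _ pq∈)))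

  valid⁻ : α ⊨ φvalid → Exclusive
  valid⁻ h ℓ a∈ b∈ a≢b ta tb αa αb
    with ∈-pairsOf⁺ (∈-inc⁺ {ℓ = ℓ} a∈ ta) (∈-inc⁺ b∈ tb) (a≢b ∘ cvar-injective)
  ... | inj₁ ab∈ = nand-true⁻ αa αb (valid-clause h ab∈)
  ... | inj₂ ba∈ = nand-true⁻ αb αa (valid-clause h ba∈)

  valid⁺ : Exclusive → α ⊨ φvalid
  valid⁺ exclusive = ⋀-intro α (concatMap layer-clauses (allFin d)) λ f∈ →
    let ℓ , _ , f∈ℓ = ∈-concatMap-elim {f = layer-clauses} {xs = allFin d} f∈
        k , _ , f∈ℓk = ∈-concatMap-elim {f = nand-clauses ℓ} {xs = allFin n} f∈ℓ
        (p , q) , pq∈ , f≡ = ∈-map⁻ nand f∈ℓk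
    in subst (α ⊨_) (sym f≡) (nand-holds pq∈)
    where
    nand : Form (Var n d) × Form (Var n d) → Form (Var n d)
    nand (p , q) = ¬ᶠ p ∨ᶠ ¬ᶠ q
    nand-clauses : Fin d → Fin n → List (Form (Var n d))
    nand-clauses ℓ k = map nand (pairsOf (inc ℓ k))
    layer-clauses : Fin d → List (Form (Var n d))
    layer-clauses ℓ = concatMap (nand-clauses ℓ) (allFin n)
    nand-holds : ∀ {ℓ k p q} → (p , q) ∈ pairsOf (inc ℓ k) → α ⊨ nand (p , q)
    nand-holds {ℓ} {k} pq∈ with ∈-pairsOf⁻ (inc-unique ℓ k) pq∈
    ... | p∈ , q∈ , p≢q with ∈-inc⁻ p∈ | ∈-inc⁻ q∈
    ...   | a , a∈ , ta , refl | b , b∈ , tb , refl =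
      nand-true⁺ (exclusive ℓ a∈ b∈ (p≢q ∘ cong (cvar ℓ)) ta tb)

  decoded : Fin d → Layer n
  decoded ℓ = select (λ a → ⟦ cvar ℓ a ⟧ α) id (pairs n)

  ∈-decoded⁻ : ∀ {ℓ a} → a ∈ decoded ℓ → a ∈ pairs n × α ⊨ cvar ℓ a
  ∈-decoded⁻ {ℓ} a∈ with ∈-select⁻ (λ a → ⟦ cvar ℓ a ⟧ α) id {xs = pairs n} a∈
  ... | _ , a∈pairs , αa , refl = a∈pairs , αa

  decoded-valid : Exclusive → ∀ ℓ → ValidLayer (decoded ℓ)
  decoded-valid exclusive ℓ = All.tabulate ordered , All.tabulate disjoint
    where
    ordered : ∀ {a} → a ∈ decoded ℓ → proj₁ a F.< proj₂ a
    ordered a∈ = ∈-pairs⁻ (proj₁ (∈-decoded⁻ a∈))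
    disjoint : ∀ {ab} → ab ∈ pairsOf (decoded ℓ) → Disjoint ab
    disjoint ab∈ =
      let a∈ , b∈ , a≢b = ∈-pairsOf⁻ (select-unique _ id id pairs-unique) ab∈
          a∈pairs , αa = ∈-decoded⁻ a∈
          b∈pairs , αb = ∈-decoded⁻ b∈
      in apart⇒disjoint λ ta tb → exclusive ℓ a∈pairs b∈pairs a≢b ta tb αa αb

  decoded-selects : ∀ ℓ {i j} → i F.< j → memᵇ (i , j) (decoded ℓ) ≡ chosen ℓ i j
  decoded-selects ℓ {i} {j} i<j with α (c ℓ i j) in αij
  ... | true = memᵇ-true⁺ (decoded ℓ) (∈-select⁺ _ id (∈-pairs⁺ i<j) αij)
  ... | false with memᵇ (i , j) (decoded ℓ) in mem
  ...   | false = refl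
  ...   | true = ⊥-elim (true≢false (trans (sym chosen-ij) αij))
    where
    chosen-ij = proj₂ (∈-decoded⁻ (memᵇ-true⁻ (decoded ℓ) mem))

  recorded : Vec Bool n → Fin (suc d) → Fin n → Bool
  recorded b ℓ k = ⟦ xT b ℓ k ⟧ α

  sort⁻ : Used → ∀ b → α ⊨ φsort b →
          (∀ ℓ → Step (chosen ℓ) (recorded b (inject₁ ℓ)) (recorded b (suc ℓ))) ×
          (∀ k → recorded b (fromℕ d) k ≡ sortB b k)
  sort⁻ used b h = let layers , output = ∧-split h in
    (λ ℓ → layer⁻ used ℓ (xT b (inject₁ ℓ)) (xT b (suc ℓ)) (⋀-map⁻ α layers (∈-allFin ℓ))) ,
    (λ k → iff-true⁻ (⋀-map⁻ α output (∈-allFin k)))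

  sort⁺ : Used → ∀ b → (∀ ℓ → Step (chosen ℓ) (recorded b (inject₁ ℓ)) (recorded b (suc ℓ))) →
          (∀ k → recorded b (fromℕ d) k ≡ sortB b k) → α ⊨ φsort b
  sort⁺ used b steps final = ∧-join
    (⋀-map⁺ α {g = λ ℓ → φlayer ℓ (xT b (inject₁ ℓ)) (xT b (suc ℓ))} {allFin d} λ {ℓ} _ →
       layer⁺ used ℓ (xT b (inject₁ ℓ)) (xT b (suc ℓ)) (steps ℓ))
    (⋀-map⁺ α {g = λ k → xT b (fromℕ d) k ⇔ᶠ const (sortB b k)} {allFin n} λ {k} _ →
       iff-true⁺ (final k))

  Ψ⁻ : ∀ {X} → α ⊨ Ψ n d X → α ⊨ φused × α ⊨ φvalid × (∀ b → X b ≡ true → α ⊨ φsort b)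
  Ψ⁻ {X} h =
    let used , rest = ∧-split h
        valid , sorts = ∧-split rest
    in used , valid , λ b Xb → ⋀-elim α sorts (∈-select⁺ X φsort (allVecs-complete b) Xb)

  Ψ⁺ : ∀ {X} → α ⊨ φused → α ⊨ φvalid → (∀ b → X b ≡ true → α ⊨ φsort b) → α ⊨ Ψ n d X
  Ψ⁺ {X} used valid sorts =
    ∧-join used (∧-join valid (⋀-intro α (select X φsort (allVecs n)) sorted-inputs))
    where
    sorted-inputs : ∀ {f} → f ∈ select X φsort (allVecs n) → α ⊨ f
    sorted-inputs f∈ with ∈-select⁻ X φsort {xs = allVecs n} f∈
    ... | b , _ , Xb , refl = sorts b Xb

  fixed⁻ : ∀ {C : Network n} → α ⊨ φfixed n d C →
           ∀ ℓ {L} → nth C (toℕ ℓ) ≡ just L → ∀ {i j} → i F.< j → chosen ℓ i j ≡ memᵇ (i , j) L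
  fixed⁻ {C} h ℓ at i<j with ⋀-map⁻ α {xs = allFin d} h (∈-allFin ℓ)
  ... | layerℓ with nth C (toℕ ℓ)
  fixed⁻ h ℓ {L} refl i<j | layerℓ | just .L = iff-true⁻ (⋀-map⁻ α {xs = pairs n} layerℓ (∈-pairs⁺ i<j))

  fixed⁺ : ∀ {C : Network n} →
           (∀ ℓ {L} → nth C (toℕ ℓ) ≡ just L → ∀ {i j} → i F.< j → chosen ℓ i j ≡ memᵇ (i , j) L) →
           α ⊨ φfixed n d C
  fixed⁺ {C} agree with ⟦ φfixed n d C ⟧ α in h
  ... | true = refl
  ... | false with ⋀-map-false α {xs = allFin d} h
  ...   | ℓ , _ , layerℓ with nth C (toℕ ℓ) in at
  ...     | nothing = ⊥-elim (true≢false layerℓ)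
  ...     | just L with ⋀-map-false α {xs = pairs n} layerℓ
  ...       | (i , j) , ij∈ , clause =
    ⊥-elim (true≢false (trans (sym (iff-true⁺ (agree ℓ at (∈-pairs⁻ ij∈)))) clause))

-- (⇒) A sorting network C ++ D of depth d yields a model of Ψ ∧ φfixed

module Encoding {n d : ℕ} (C D : Network n) (cn : ComparatorNetwork (C ++ D))
                (depth : length (C ++ D) ≡ d) (sorts : Sorts (C ++ D)) where
  open ≡-Reasoning

  N : Network n
  N = C ++ D

  layer-exists : ∀ (ℓ : Fin d) → ∃ λ L → nth N (toℕ ℓ) ≡ just L
  layer-exists ℓ = nth-defined N (subst (toℕ ℓ <_) (sym depth) (FinP.toℕ<n ℓ))

  layer : Fin d → Layer n
  layer = proj₁ ∘ layer-exists

  comparators : Var n d → Bool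
  comparators (c ℓ i j) = memᵇ (i , j) (layer ℓ)
  comparators _ = false

  α : Var n d → Bool
  α (c ℓ i j) = memᵇ (i , j) (layer ℓ)
  α (u ℓ k) = ⟦ ⋁ (inc ℓ k) ⟧ comparators
  α (x b ℓ k) = prefix N (lookup b) (suc (toℕ ℓ)) k

  layer-of : ∀ ℓ → IsLayer N (toℕ ℓ) (chosen α ℓ) (layer ℓ)
  layer-of ℓ = record { at = at ; valid = nth-All cn at ; selects = λ _ → refl }
    where at = proj₂ (layer-exists ℓ)

  -- inc ℓ k mentions comparator variables only, on which α and comparators agree
  used : Used α
  used ℓ k = ⋁-cong comparators α (inc ℓ k) same
    where
    same : ∀ {f} → f ∈ inc ℓ k → ⟦ f ⟧ comparators ≡ ⟦ f ⟧ α
    same f∈ with ∈-inc⁻ f∈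
    ... | _ , _ , _ , refl = refl

  exclusive : Exclusive α
  exclusive ℓ _ _ a≢b ta tb αa αb =
    valid-apart (IsLayer.valid (layer-of ℓ)) (memᵇ-true⁻ (layer ℓ) αa) (memᵇ-true⁻ (layer ℓ) αb) a≢b ta tb

  recorded-prefix : ∀ b ℓ k → recorded α b ℓ k ≡ prefix N (lookup b) (toℕ ℓ) k
  recorded-prefix b zero k = refl
  recorded-prefix b (suc ℓ) k = refl

  steps : ∀ b ℓ → Step (chosen α ℓ) (recorded α b (inject₁ ℓ)) (recorded α b (suc ℓ))
  steps b ℓ = Step-resp before (prefix-step N (IsLayer.at (layer-of ℓ)) (lookup b))
                        (IsLayer-Step (layer-of ℓ) (prefix N (lookup b) (toℕ ℓ)))
    where
    before : ∀ k → prefix N (lookup b) (toℕ ℓ) k ≡ recorded α b (inject₁ ℓ) k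
    before k = sym (trans (recorded-prefix b (inject₁ ℓ) k)
                          (cong (λ m → prefix N (lookup b) m k) (FinP.toℕ-inject₁ ℓ)))

  final : ∀ b k → recorded α b (fromℕ d) k ≡ sortB b k
  final b k = begin
    recorded α b (fromℕ d) k               ≡⟨ recorded-prefix b (fromℕ d) k ⟩
    prefix N (lookup b) (toℕ (fromℕ d)) k  ≡⟨ cong (λ m → prefix N (lookup b) m k) (FinP.toℕ-fromℕ d) ⟩
    prefix N (lookup b) d k                ≡⟨ cong (λ w → w k) (prefix-all N depth (lookup b)) ⟩
    runB N (lookup b) k                    ≡⟨ sorting-output N cn sorts b k ⟩
    sortB b k                              ∎

  agrees-with-C : ∀ ℓ {L} → nth C (toℕ ℓ) ≡ just L → ∀ {i j} → i F.< j → chosen α ℓ i j ≡ memᵇ (i , j) L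
  agrees-with-C ℓ at {i} {j} _ = cong (memᵇ (i , j))
    (just-injective (trans (sym (IsLayer.at (layer-of ℓ))) (trans (nth-++ˡ C D (nth-bound C at)) at)))

  satisfies : α ⊨ (Ψ n d (Bun C) ∧ᶠ φfixed n d C)
  satisfies = ∧-join
    (Ψ⁺ α (used⁺ α used) (valid⁺ α exclusive) (λ b _ → sort⁺ α used b (steps b) (final b)))
    (fixed⁺ α {C = C} agrees-with-C)

-- (⇐) A model of Ψ ∧ φfixed yields a continuation D making C ++ D a sorting network

module Decoding {n d : ℕ} (C : Network n) (cnC : ComparatorNetwork C) (short : length C ≤ d)
                (α : Var n d → Bool) (sat : α ⊨ (Ψ n d (Bun C) ∧ᶠ φfixed n d C)) where
  open ≡-Reasoning

  model : α ⊨ φused × α ⊨ φvalid × (∀ b → Bun C b ≡ true → α ⊨ φsort b)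
  model = Ψ⁻ α (proj₁ (∧-split sat))

  used : Used α
  used = used⁻ α (proj₁ model)

  exclusive : Exclusive α
  exclusive = valid⁻ α (proj₁ (proj₂ model))

  D : Network n
  D = drop (length C) (tabulate (decoded α))

  N : Network n
  N = C ++ D

  D-valid : ComparatorNetwork D
  D-valid = AllP.drop⁺ (length C) (AllP.tabulate⁺ (decoded-valid α exclusive))

  N-valid : ComparatorNetwork N
  N-valid = AllP.++⁺ cnC D-valid

  depth : length N ≡ d
  depth = begin
    length (C ++ D)            ≡⟨ ListP.length-++ C ⟩
    length C + length D        ≡⟨ cong (length C +_) (ListP.length-drop (length C) (tabulate (decoded α))) ⟩
    length C + (length (tabulate (decoded α)) ∸ length C)
                               ≡⟨ cong (λ m → length C + (m ∸ length C)) (ListP.length-tabulate (decoded α)) ⟩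
    length C + (d ∸ length C)  ≡⟨ ℕP.m+[n∸m]≡n short ⟩
    d                          ∎

  -- every layer of N selects the comparators chosen by α: those of C by φfixed, the others by decoding
  layer : ∀ ℓ → ∃ (IsLayer N (toℕ ℓ) (chosen α ℓ))
  layer ℓ with toℕ ℓ <? length C
  ... | yes inC =
    let L , at = nth-defined C inC in
    L , record { at = trans (nth-++ˡ C D inC) at ; valid = nth-All cnC at
               ; selects = λ i<j → sym (fixed⁻ α {C = C} (proj₂ (∧-split sat)) ℓ at i<j) }
  ... | no notInC = decoded α ℓ ,
    record { at = at ; valid = decoded-valid α exclusive ℓ ; selects = decoded-selects α ℓ }
    where
    m = toℕ ℓ ∸ length C
    split : length C + m ≡ toℕ ℓ
    split = ℕP.m+[n∸m]≡n (ℕP.≮⇒≥ notInC)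
    at : nth N (toℕ ℓ) ≡ just (decoded α ℓ)
    at = begin
      nth N (toℕ ℓ)                               ≡⟨ cong (nth N) (sym split) ⟩
      nth N (length C + m)                        ≡⟨ nth-++ʳ C D m ⟩
      nth D m                                     ≡⟨ nth-drop (length C) (tabulate (decoded α)) m ⟩
      nth (tabulate (decoded α)) (length C + m)   ≡⟨ cong (nth (tabulate (decoded α))) split ⟩
      nth (tabulate (decoded α)) (toℕ ℓ)          ≡⟨ nth-tabulate (decoded α) ℓ ⟩
      just (decoded α ℓ)                          ∎

  -- inputs left unsorted by C follow the recorded traces to sortB b; the others are sorted by C already
  sorts-vector : ∀ b → Sorted (runB N (lookup b))
  sorts-vector b with Bun C b in unsorted
  ... | true =
    let steps , final = sort⁻ α used b (proj₂ (proj₂ model) b unsorted) in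
    Sorted-resp (λ k → sym (trans (run-trace N depth layer (recorded α b) steps k) (final k))) (sortB-sorted b)
  ... | false =
    let sortedC = sortedᵇ⇒Sorted _ (not-false⁻ unsorted) in
    Sorted-resp (λ k → sym (trans (cong (λ w → w k) (run-++ C D (lookup b))) (run-sorted D D-valid sortedC k)))
                sortedC
    where
    not-false⁻ : ∀ {a} → not a ≡ false → a ≡ true
    not-false⁻ {true} _ = refl

  sorts : Sorts N
  sorts = zero-one-principle N λ v →
    Sorted-resp (run-cong N (VecP.lookup∘tabulate v)) (sorts-vector (Vec.tabulate v))

lemma11 : (n d : ℕ) → 1 ≤ n → 1 ≤ d → (C : Network n) → ComparatorNetwork C → length C ≤ d →
    (∃ λ (D : Network n) → IsSortingNetwork n d (C ++ D))
    ⇔ Satisfiable (Ψ n d (Bun C) ∧ᶠ φfixed n d C)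
lemma11 n d _ _ C cnC short = mk⇔ encode decode
  where
  encode : (∃ λ (D : Network n) → IsSortingNetwork n d (C ++ D)) →
           Satisfiable (Ψ n d (Bun C) ∧ᶠ φfixed n d C)
  encode (D , cn , depth , sorts) = Encoding.α C D cn depth sorts , Encoding.satisfies C D cn depth sorts

  decode : Satisfiable (Ψ n d (Bun C) ∧ᶠ φfixed n d C) →
           ∃ λ (D : Network n) → IsSortingNetwork n d (C ++ D)
  decode (α , sat) = let open Decoding C cnC short α sat in D , N-valid , depth , sorts
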